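{- Let $\mathcal P$ be a finite set of points in $\mathbb C^2$ and let $\mathcal L=\mathcal L(\mathcal P)$. Then $$|Q(\mathcal P)|\leq \big|\{(L,L')\in\mathcal L^2: L \text{ and } L' \text{ are contained in a common plane that is not bad}\}\big|.$$
   Context: For $p,q\in\mathbb C^2$, $\Delta(p,q)=(p_x-q_x)^2+(p_y-q_y)^2$. $Q(\mathcal P)=\{(a,b,c,d)\in\mathcal P^4:\Delta(a,b)=\Delta(c,d)\neq0 \text{ and } (a,b)\neq(c,d)\}$. For $a=(a_x,a_y),c=(c_x,c_y)\in\mathbb C^2$, $\ell_{a,c}$ is the line in $\mathbb C^3$ defined by $2x=(a_x+c_x)+(a_y-c_y)z$ and $2y=(a_y+c_y)+(c_x-a_x)z$, and $\mathcal L(\mathcal P)=\{\ell_{a,c}:(a,c)\in\mathcal P^2\}$. A plane in $\mathbb C^3$ is bad if it equals $Z(y+ix+k)$ or $Z(y-ix+k)$ for some $k\in\mathbb C$. -}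

module Defs where

open import Level using (0ℓ)
open import Algebra.Bundles using (CommutativeRing)
open import Data.Nat using (ℕ; zero; suc)
open import Data.Fin using (Fin)
open import Data.List using (List; []; _∷_; _++_; [_])
open import Data.List.Relation.Unary.Any using (Any)
open import Data.Product using (Σ; ∃; _×_; _,_)
open import Data.Sum using (_⊎_)
open import Relation.Nullary using (¬_)
open import Relation.Binary.PropositionalEquality using (_≡_)

IsCard : {A : Set} → (A → A → Set) → (A → Set) → ℕ → Set
IsCard {A} _~_ S n =
  Σ (Fin n → A) λ f →
    (∀ i → S (f i)) ×
    (∀ i j → f i ~ f j → i ≡ j) ×
    (∀ x → S x → ∃ λ i → x ~ f i)

module RingOps (R : CommutativeRing 0ℓ 0ℓ) where
  open CommutativeRing R
  natTimes : ℕ → Carrier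
  natTimes zero = 0#
  natTimes (suc n) = 1# + natTimes n
  -- evaluation of a coefficient list (constant term first), Horner scheme
  eval : List Carrier → Carrier → Carrier
  eval [] x = 0#
  eval (a ∷ as) x = a + x * eval as x

-- An algebraically closed field of characteristic 0 (stands in for ℂ).
record ACF0 : Set₁ where
  field
    cring : CommutativeRing 0ℓ 0ℓ
  open CommutativeRing cring
  open RingOps cring
  field
    nontrivial : ¬ (1# ≈ 0#)
    inverse    : ∀ x → ¬ (x ≈ 0#) → ∃ λ y → x * y ≈ 1#
    char0      : ∀ n → ¬ (natTimes (suc n) ≈ 0#)
    -- every monic polynomial of degree ≥ 1 has a root
    algClosed  : ∀ (a : Carrier) (as : List Carrier) →
                 ∃ λ x → eval (a ∷ (as ++ [ 1# ])) x ≈ 0#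

module Geometry (K : ACF0) where
  open ACF0 K
  open CommutativeRing cring

  Point2 : Set
  Point2 = Carrier × Carrier

  Point3 : Set
  Point3 = Carrier × Carrier × Carrier

  _≈₂_ : Point2 → Point2 → Set
  (a , b) ≈₂ (c , d) = (a ≈ c) × (b ≈ d)

  _∈P_ : Point2 → List Point2 → Set
  p ∈P 𝒫 = Any (p ≈₂_) 𝒫

  two : Carrier
  two = 1# + 1#

  sq : Carrier → Carrier
  sq x = x * x

  Δ : Point2 → Point2 → Carrier
  Δ (px , py) (qx , qy) = sq (px - qx) + sq (py - qy)

  Quad : Set
  Quad = Point2 × Point2 × Point2 × Point2

  _≈₄_ : Quad → Quad → Set
  (a , b , c , d) ≈₄ (a' , b' , c' , d') =
    (a ≈₂ a') × (b ≈₂ b') × (c ≈₂ c') × (d ≈₂ d')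

  Q : List Point2 → Quad → Set
  Q 𝒫 (a , b , c , d) =
    a ∈P 𝒫 × b ∈P 𝒫 × c ∈P 𝒫 × d ∈P 𝒫 ×
    Δ a b ≈ Δ c d × ¬ (Δ a b ≈ 0#) × ¬ ((a ≈₂ c) × (b ≈₂ d))

  ℓ : Point2 → Point2 → Point3 → Set
  ℓ (ax , ay) (cx , cy) (x , y , z) =
    (two * x ≈ (ax + cx) + (ay - cy) * z) ×
    (two * y ≈ (ay + cy) + (cx - ax) * z)

  SameSet : (Point3 → Set) → (Point3 → Set) → Set
  SameSet S T = ∀ p → (S p → T p) × (T p → S p)

  _⊆_ : (Point3 → Set) → (Point3 → Set) → Set
  S ⊆ T = ∀ p → S p → T p

  record Plane : Set where
    constructor plane
    field
      α β γ δ : Carrier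
      nondeg : ¬ ((α ≈ 0#) × (β ≈ 0#) × (γ ≈ 0#))

  Z : Carrier → Carrier → Carrier → Carrier → Point3 → Set
  Z α β γ δ (x , y , z) = α * x + β * y + γ * z + δ ≈ 0#

  ZP : Plane → Point3 → Set
  ZP (plane α β γ δ _) = Z α β γ δ

  Bad : Plane → Set
  Bad π = ∃ λ k → ∃ λ i → (i * i ≈ - 1#) ×
    (SameSet (ZP π) (Z i 1# 0# k) ⊎ SameSet (ZP π) (Z (- i) 1# 0# k))

  -- elements of ℒ(𝒫) are represented by pairs (a,c) ∈ 𝒫², identified
  -- when they give the same line (as subsets of K³)
  LineRep : Set
  LineRep = Point2 × Point2

  _≈L_ : LineRep → LineRep → Set
  (a , c) ≈L (a' , c') = SameSet (ℓ a c) (ℓ a' c')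

  _≈LL_ : LineRep × LineRep → LineRep × LineRep → Set
  (L₁ , L₂) ≈LL (L₁' , L₂') = (L₁ ≈L L₁') × (L₂ ≈L L₂')

  InL : List Point2 → LineRep → Set
  InL 𝒫 (a , c) = a ∈P 𝒫 × c ∈P 𝒫

  GoodPair : List Point2 → LineRep × LineRep → Set
  GoodPair 𝒫 ((a , c) , (a' , c')) =
    InL 𝒫 (a , c) × InL 𝒫 (a' , c') ×
    ∃ λ (π : Plane) → (ℓ a c ⊆ ZP π) × (ℓ a' c' ⊆ ZP π) × ¬ Bad π

-- Send (a, b, c, d) ∈ Q(𝒫) to the pair of lines (ℓ_{a,c}, ℓ_{b,d}).
-- (1) The line ℓ_{a,c} = {2x = X + Dx z, 2y = Y + Dy z} determines its
--     coefficients X = a₁+c₁, Y = a₂+c₂, Dx = a₂-c₂, Dy = c₁-a₁, and these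
--     determine a and c (as 2 ≠ 0); so the map reflects the equivalences.
-- (2) A plane αx+βy+γz+δ = 0 contains such a line iff αX+βY+2δ = 0 and
--     αDx+βDy+2γ = 0.  Both lines lie in a common plane iff the 2×2 system
--     for (α, β) whose rows are the differences of their coefficients has a
--     nonzero solution; its determinant is Δ(c,d) - Δ(a,b) = 0, and its
--     entries do not all vanish since Δ(a,b) ≠ 0.
-- (3) If both lines lie in Z(s x + y + k) with s² = -1, then Δ(a,b) = 0; so
--     the common plane is not bad.  Constructively, choosing the kernel
-- vector in (2) needs a case split on an undecidable equality, so (2) holds
-- up to double negation, which is harmless because n ≤ m is decidable.

module Submission where

open import Level using (0ℓ)
open import Algebra.Bundles using (CommutativeRing)
open import Algebra.Solver.Ring.AlmostCommutativeRing
  using (_-Raw-AlmostCommutative⟶_; fromCommutativeRing)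
open import Data.Nat as ℕ using (ℕ; zero; suc; _≤_; _≤?_)
import Data.Nat.Properties as ℕP
open import Data.Integer as ℤ using (ℤ; +_; -[1+_]; _⊖_; sign; ∣_∣; _◃_)
import Data.Integer.Properties as ℤP
open import Data.Sign as Sign using (Sign)
open import Data.Maybe using (Maybe; just; nothing)
open import Data.Fin using (Fin)
open import Data.Fin.Properties using (injective⇒≤; sequence)
open import Data.List using (List)
open import Data.Product using (∃₂; _×_; _,_; proj₁; proj₂)
open import Data.Sum using (_⊎_; inj₁; inj₂)
open import Effect.Monad using (RawMonad)
open import Relation.Binary.PropositionalEquality as ≡ using (_≡_)
open import Relation.Nullary using (¬_; Dec; yes; no)
open import Relation.Nullary.Negation using (¬¬-Monad; ¬¬-map)
open import Relation.Nullary.Decidable using (decidable-stable; ¬¬-excluded-middle)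

open import Defs

-- Every commutative ring R receives the canonical ring map ℤ → R, which
-- lets the standard ring solver normalise identities in R with integer
-- coefficients (so that e.g. x - x ≈ 0# is recognised).
module IntegerCoefficients (R : CommutativeRing 0ℓ 0ℓ) where
  open CommutativeRing R
  open import Algebra.Properties.Ring ring using (-1*x≈-x)
  open import Algebra.Properties.AbelianGroup +-abelianGroup
    using (⁻¹-∙-comm; ⁻¹-involutive; ε⁻¹≈ε)
  open import Algebra.Properties.CommutativeSemigroup +-commutativeSemigroup
    using () renaming (interchange to +-interchange)
  open import Algebra.Properties.CommutativeSemigroup *-commutativeSemigroup
    using () renaming (interchange to *-interchange)
  open import Algebra.Properties.Semiring.Mult.TCOptimised semiring
    using (1+×; ×-homo-+; ×1-homo-*) renaming (_×_ to _×′_)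
  open import Relation.Binary.Reasoning.Setoid setoid

  -- the image of a natural number; note that 2 ↦ 1# + 1# definitionally
  nat : ℕ → Carrier
  nat n = n ×′ 1#

  sgn : Sign → Carrier
  sgn Sign.+ = 1#
  sgn Sign.- = - 1#

  ⟦_⟧ : ℤ → Carrier
  ⟦ + n ⟧      = nat n
  ⟦ -[1+ n ] ⟧ = - nat (suc n)

  -- The map respects multiplication via the sign–magnitude form of integers,
  -- and addition by induction on the natural-number subtraction _⊖_.
  sgn-homo : ∀ s t → sgn (s Sign.* t) ≈ sgn s * sgn t
  sgn-homo Sign.+ t      = sym (*-identityˡ _)
  sgn-homo Sign.- Sign.+ = sym (*-identityʳ _)
  sgn-homo Sign.- Sign.- = sym (trans (-1*x≈-x (- 1#)) (⁻¹-involutive 1#))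

  ◃-homo : ∀ s n → ⟦ s ◃ n ⟧ ≈ sgn s * nat n
  ◃-homo s      zero    = sym (zeroʳ _)
  ◃-homo Sign.+ (suc n) = sym (*-identityˡ _)
  ◃-homo Sign.- (suc n) = sym (-1*x≈-x _)

  sign-magnitude : ∀ i → ⟦ i ⟧ ≈ sgn (sign i) * nat ∣ i ∣
  sign-magnitude (+ n)    = sym (*-identityˡ _)
  sign-magnitude -[1+ n ] = sym (-1*x≈-x _)

  *-homo : ∀ i j → ⟦ i ℤ.* j ⟧ ≈ ⟦ i ⟧ * ⟦ j ⟧
  *-homo i j = begin
    ⟦ (sign i Sign.* sign j) ◃ (∣ i ∣ ℕ.* ∣ j ∣) ⟧
      ≈⟨ ◃-homo (sign i Sign.* sign j) (∣ i ∣ ℕ.* ∣ j ∣) ⟩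
    sgn (sign i Sign.* sign j) * nat (∣ i ∣ ℕ.* ∣ j ∣)
      ≈⟨ *-cong (sgn-homo (sign i) (sign j)) (×1-homo-* ∣ i ∣ ∣ j ∣) ⟩
    (sgn (sign i) * sgn (sign j)) * (nat ∣ i ∣ * nat ∣ j ∣)
      ≈⟨ *-interchange _ _ _ _ ⟩
    (sgn (sign i) * nat ∣ i ∣) * (sgn (sign j) * nat ∣ j ∣)
      ≈⟨ *-cong (sign-magnitude i) (sign-magnitude j) ⟨
    ⟦ i ⟧ * ⟦ j ⟧ ∎

  ⊖-homo : ∀ m n → ⟦ m ⊖ n ⟧ ≈ nat m - nat n
  ⊖-homo m       zero    = sym (trans (+-congˡ ε⁻¹≈ε) (+-identityʳ _))
  ⊖-homo zero    (suc n) = sym (+-identityˡ _)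
  ⊖-homo (suc m) (suc n) = begin
    ⟦ suc m ⊖ suc n ⟧             ≡⟨ ≡.cong ⟦_⟧ (ℤP.[1+m]⊖[1+n]≡m⊖n m n) ⟩
    ⟦ m ⊖ n ⟧                     ≈⟨ ⊖-homo m n ⟩
    nat m - nat n                 ≈⟨ +-identityˡ _ ⟨
    0# + (nat m - nat n)          ≈⟨ +-congʳ (-‿inverseʳ 1#) ⟨
    (1# - 1#) + (nat m - nat n)   ≈⟨ +-interchange _ _ _ _ ⟩
    (1# + nat m) + (- 1# - nat n) ≈⟨ +-congˡ (⁻¹-∙-comm 1# (nat n)) ⟩
    (1# + nat m) - (1# + nat n)   ≈⟨ +-cong (1+× m 1#) (-‿cong (1+× n 1#)) ⟨
    nat (suc m) - nat (suc n)     ∎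

  +-homo : ∀ i j → ⟦ i ℤ.+ j ⟧ ≈ ⟦ i ⟧ + ⟦ j ⟧
  +-homo (+ m)    (+ n)    = ×-homo-+ 1# m n
  +-homo (+ m)    -[1+ n ] = ⊖-homo m (suc n)
  +-homo -[1+ m ] (+ n)    = trans (⊖-homo n (suc m)) (+-comm _ _)
  +-homo -[1+ m ] -[1+ n ] = begin
    - nat (suc (suc (m ℕ.+ n)))    ≡⟨ ≡.cong (λ k → - nat (suc k)) (ℕP.+-suc m n) ⟨
    - nat (suc m ℕ.+ suc n)        ≈⟨ -‿cong (×-homo-+ 1# (suc m) (suc n)) ⟩
    - (nat (suc m) + nat (suc n))  ≈⟨ ⁻¹-∙-comm _ _ ⟨
    - nat (suc m) - nat (suc n)    ∎

  neg-homo : ∀ i → ⟦ ℤ.- i ⟧ ≈ - ⟦ i ⟧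
  neg-homo (+ zero)  = sym ε⁻¹≈ε
  neg-homo (+ suc n) = refl
  neg-homo -[1+ n ]  = sym (⁻¹-involutive _)

  homomorphism : ℤ.+-*-rawRing -Raw-AlmostCommutative⟶ fromCommutativeRing R
  homomorphism = record
    { ⟦_⟧ = ⟦_⟧ ; +-homo = +-homo ; *-homo = *-homo ; -‿homo = neg-homo
    ; 0-homo = refl ; 1-homo = refl }

  coefficients-equal? : ∀ i j → Maybe (⟦ i ⟧ ≈ ⟦ j ⟧)
  coefficients-equal? i j with i ℤ.≟ j
  ... | yes ≡.refl = just refl
  ... | no _       = nothing

  open import Algebra.Solver.Ring ℤ.+-*-rawRing (fromCommutativeRing R)
    homomorphism coefficients-equal? public
    using (Polynomial; solve; _:=_; _:+_; _:*_; _:-_; :-_; con)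

  𝟘 𝟙 𝟚 : ∀ {k} → Polynomial k
  𝟘 = con (+ 0)
  𝟙 = con (+ 1)
  𝟚 = con (+ 2)

module LinearAlgebra (R : CommutativeRing 0ℓ 0ℓ) where
  open CommutativeRing R
  open IntegerCoefficients R
  open import Algebra.Properties.AbelianGroup +-abelianGroup using (⁻¹-involutive; ε⁻¹≈ε)
  open import Relation.Binary.Reasoning.Setoid setoid

  neg-zero : ∀ {x} → - x ≈ 0# → x ≈ 0#
  neg-zero {x} e = trans (sym (⁻¹-involutive x)) (trans (-‿cong e) ε⁻¹≈ε)

  -- A 2×2 system  α p + β q = 0,  α r + β t = 0  with vanishing determinant
  -- and not all coefficients zero has a nontrivial solution (α, β): take
  -- (q, -p) when the first row is nonzero, and (t, -r) otherwise.  Whether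
  -- the first row is zero is not decidable, hence the double negation.
  singular-kernel : ∀ {p q r t} → p * t - q * r ≈ 0# →
    ¬ (p ≈ 0# × q ≈ 0# × r ≈ 0# × t ≈ 0#) →
    ¬ ¬ (∃₂ λ α β → ¬ (α ≈ 0# × β ≈ 0#) ×
                    α * p + β * q ≈ 0# × α * r + β * t ≈ 0#)
  singular-kernel {p} {q} {r} {t} det≈0 nonzero =
    ¬¬-map choose (¬¬-excluded-middle {A = p ≈ 0# × q ≈ 0#})
    where
    orthogonal : ∀ x y → x * y + - y * x ≈ 0#
    orthogonal = solve 2 (λ x y → x :* y :+ :- y :* x := 𝟘) refl

    choose : Dec (p ≈ 0# × q ≈ 0#) → ∃₂ λ α β → ¬ (α ≈ 0# × β ≈ 0#) ×
                    α * p + β * q ≈ 0# × α * r + β * t ≈ 0#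
    choose (no first-row≉0) =
      q , - p , (λ (q≈0 , -p≈0) → first-row≉0 (neg-zero -p≈0 , q≈0)) ,
      orthogonal q p ,
      (begin
        q * r + - p * t ≈⟨ solve 4 (λ p q r t → q :* r :+ :- p :* t := :- (p :* t :- q :* r)) refl p q r t ⟩
        - (p * t - q * r) ≈⟨ -‿cong det≈0 ⟩
        - 0#              ≈⟨ ε⁻¹≈ε ⟩
        0#                ∎)
    choose (yes (p≈0 , q≈0)) =
      t , - r , (λ (t≈0 , -r≈0) → nonzero (p≈0 , q≈0 , neg-zero -r≈0 , t≈0)) ,
      trans (solve 4 (λ p q r t → t :* p :+ :- r :* q := p :* t :- q :* r) refl p q r t) det≈0 ,
      orthogonal t r

-- If Φ : A → B reflects the
-- equivalences and sends every element of S into T (up to double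
-- negation), then |S| ≤ |T|: composing an enumeration of S with Φ and with
-- the "index in T" map of an enumeration of T gives an injection
-- Fin n → Fin m.  The double negation is harmless because n ≤ m is
-- decidable, and it is pushed through the finite quantifier over Fin n.
card-≤ : {A B : Set} {_~_ : A → A → Set} {_≈_ : B → B → Set}
  {S : A → Set} {T : B → Set} {n m : ℕ} →
  (∀ {x y} → x ≈ y → y ≈ x) → (∀ {x y z} → x ≈ y → y ≈ z → x ≈ z) →
  (Φ : A → B) → (∀ x y → Φ x ≈ Φ y → x ~ y) → (∀ x → S x → ¬ ¬ T (Φ x)) →
  IsCard _~_ S n → IsCard _≈_ T m → n ≤ m
card-≤ {_≈_ = _≈_} {T = T} {n} {m} ≈-sym ≈-trans Φ reflects maps-into
       (f , f∈S , f-injective , _) (g , _ , _ , g-onto) =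
  decidable-stable (n ≤? m)
    (¬¬-map injection-≤
      (sequence (RawMonad.rawApplicative ¬¬-Monad) (λ i → maps-into (f i) (f∈S i))))
  where
  injection-≤ : (∀ i → T (Φ (f i))) → n ≤ m
  injection-≤ Φf∈T = injective⇒≤ index-injective
    where
    index : Fin n → Fin m
    index i = proj₁ (g-onto (Φ (f i)) (Φf∈T i))

    at-index : ∀ i → Φ (f i) ≈ g (index i)
    at-index i = proj₂ (g-onto (Φ (f i)) (Φf∈T i))

    index-injective : ∀ {i j} → index i ≡ index j → i ≡ j
    index-injective {i} {j} eq = f-injective i j (reflects (f i) (f j)
      (≈-trans (at-index i) (≈-sym (≡.subst (λ k → Φ (f j) ≈ g k) (≡.sym eq) (at-index j)))))

module LinesAndPlanes (K : ACF0) where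
  open ACF0 K
  open CommutativeRing cring
  open Geometry K
  open IntegerCoefficients cring
  open import Algebra.Properties.Group +-group using (ε⁻¹≈ε)
  open import Relation.Binary.Reasoning.Setoid setoid

  two≉0 : ¬ (two ≈ 0#)
  two≉0 two≈0 = char0 1 (trans (+-congˡ (+-identityʳ 1#)) two≈0)

  half : Carrier
  half = proj₁ (inverse two two≉0)

  two*half : two * half ≈ 1#
  two*half = proj₂ (inverse two two≉0)

  double-of-half : ∀ x → two * (half * x) ≈ x
  double-of-half x = begin
    two * (half * x) ≈⟨ solve 2 (λ h x → 𝟚 :* (h :* x) := (𝟚 :* h) :* x) refl half x ⟩
    (two * half) * x ≈⟨ *-congʳ two*half ⟩
    1# * x           ≈⟨ *-identityˡ x ⟩
    x                ∎

  half-of-double : ∀ x → half * (two * x) ≈ x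
  half-of-double x =
    trans (solve 2 (λ h x → h :* (𝟚 :* x) := 𝟚 :* (h :* x)) refl half x) (double-of-half x)

  halve : ∀ {x y} → two * x ≈ two * y → x ≈ y
  halve {x} {y} e = trans (sym (half-of-double x)) (trans (*-congˡ e) (half-of-double y))

  halve-zero : ∀ {x} → two * x ≈ 0# → x ≈ 0#
  halve-zero e = halve (trans e (sym (zeroʳ two)))

  -- An affine function z ↦ a + b z determines its coefficients
  -- (evaluate at z = 0 and z = 1).
  affine-unique : ∀ {a b a' b'} → (∀ z → a + b * z ≈ a' + b' * z) → a ≈ a' × b ≈ b'
  affine-unique {a} {b} {a'} {b'} agree = a≈a' , b≈b'
    where
    constant : ∀ u v → u + v * 0# ≈ u
    constant u v = trans (+-congˡ (zeroʳ v)) (+-identityʳ u)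

    a≈a' : a ≈ a'
    a≈a' = trans (sym (constant a b)) (trans (agree 0#) (constant a' b'))

    slope : ∀ u v → v ≈ (u + v * 1#) - u
    slope = solve 2 (λ u v → v := (u :+ v :* 𝟙) :- u) refl

    b≈b' : b ≈ b'
    b≈b' = begin
      b                   ≈⟨ slope a b ⟩
      (a + b * 1#) - a    ≈⟨ +-cong (agree 1#) (-‿cong a≈a') ⟩
      (a' + b' * 1#) - a' ≈⟨ slope a' b' ⟨
      b'                  ∎

  record LineData : Set where
    constructor line
    field X Y Dx Dy : Carrier

  OnLine : LineData → Point3 → Set
  OnLine (line X Y Dx Dy) (x , y , z) = (two * x ≈ X + Dx * z) × (two * y ≈ Y + Dy * z)

  SameData : LineData → LineData → Set
  SameData (line X Y Dx Dy) (line X' Y' Dx' Dy') = X ≈ X' × Y ≈ Y' × Dx ≈ Dx' × Dy ≈ Dy'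

  -- the coefficients of ℓ_{a,c}: ℓ a c is OnLine (coefficients a c) by definition
  coefficients : Point2 → Point2 → LineData
  coefficients (ax , ay) (cx , cy) = line (ax + cx) (ay + cy) (ay - cy) (cx - ax)

  pointAt : LineData → Carrier → Point3
  pointAt (line X Y Dx Dy) z = half * (X + Dx * z) , half * (Y + Dy * z) , z

  pointAt-on : ∀ L z → OnLine L (pointAt L z)
  pointAt-on (line X Y Dx Dy) z = double-of-half _ , double-of-half _

  coefficients-unique : ∀ L L' → OnLine L ⊆ OnLine L' → SameData L L'
  coefficients-unique L@(line X Y Dx Dy) (line X' Y' Dx' Dy') L⊆L' =
    proj₁ x-coeffs , proj₁ y-coeffs , proj₂ x-coeffs , proj₂ y-coeffs
    where
    x-coeffs : X ≈ X' × Dx ≈ Dx'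
    x-coeffs = affine-unique λ z →
      trans (sym (double-of-half _)) (proj₁ (L⊆L' (pointAt L z) (pointAt-on L z)))
    y-coeffs : Y ≈ Y' × Dy ≈ Dy'
    y-coeffs = affine-unique λ z →
      trans (sym (double-of-half _)) (proj₂ (L⊆L' (pointAt L z) (pointAt-on L z)))

  sum-difference-unique : ∀ {x y x' y'} → x + y ≈ x' + y' → x - y ≈ x' - y' → x ≈ x' × y ≈ y'
  sum-difference-unique {x} {y} {x'} {y'} s d =
    halve (trans (doubled-first x y) (trans (+-cong s d) (sym (doubled-first x' y')))) ,
    halve (trans (doubled-second x y) (trans (+-cong s (-‿cong d)) (sym (doubled-second x' y'))))
    where
    doubled-first : ∀ u v → two * u ≈ (u + v) + (u - v)
    doubled-first = solve 2 (λ u v → 𝟚 :* u := (u :+ v) :+ (u :- v)) refl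
    doubled-second : ∀ u v → two * v ≈ (u + v) - (u - v)
    doubled-second = solve 2 (λ u v → 𝟚 :* v := (u :+ v) :- (u :- v)) refl

  points-unique : ∀ a c a' c' → SameData (coefficients a c) (coefficients a' c') →
    (a ≈₂ a') × (c ≈₂ c')
  points-unique (ax , ay) (cx , cy) (ax' , ay') (cx' , cy') (sx , sy , dy , dx) =
    (proj₂ first , proj₁ second) , (proj₁ first , proj₂ second)
    where
    first : cx ≈ cx' × ax ≈ ax'
    first = sum-difference-unique (trans (+-comm cx ax) (trans sx (+-comm ax' cx'))) dx
    second : ay ≈ ay' × cy ≈ cy'
    second = sum-difference-unique sy dy

  ℓ-injective : ∀ a c a' c' → ℓ a c ⊆ ℓ a' c' → (a ≈₂ a') × (c ≈₂ c')
  ℓ-injective a c a' c' ℓ⊆ℓ' =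
    points-unique a c a' c' (coefficients-unique (coefficients a c) (coefficients a' c') ℓ⊆ℓ')

  form-along-line : ∀ α β γ δ L x y z → OnLine L (x , y , z) →
    two * (α * x + β * y + γ * z + δ) ≈
      (α * LineData.X L + β * LineData.Y L + two * δ) +
      (α * LineData.Dx L + β * LineData.Dy L + two * γ) * z
  form-along-line α β γ δ (line X Y Dx Dy) x y z (on-x , on-y) = begin
    two * (α * x + β * y + γ * z + δ)
      ≈⟨ solve 7 (λ α β γ δ x y z → 𝟚 :* (α :* x :+ β :* y :+ γ :* z :+ δ)
                   := α :* (𝟚 :* x) :+ β :* (𝟚 :* y) :+ 𝟚 :* γ :* z :+ 𝟚 :* δ)
                 refl α β γ δ x y z ⟩
    α * (two * x) + β * (two * y) + two * γ * z + two * δ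
      ≈⟨ +-congʳ (+-congʳ (+-cong (*-congˡ on-x) (*-congˡ on-y))) ⟩
    α * (X + Dx * z) + β * (Y + Dy * z) + two * γ * z + two * δ
      ≈⟨ solve 9 (λ α β γ δ X Y Dx Dy z →
                   α :* (X :+ Dx :* z) :+ β :* (Y :+ Dy :* z) :+ 𝟚 :* γ :* z :+ 𝟚 :* δ
                   := (α :* X :+ β :* Y :+ 𝟚 :* δ) :+ (α :* Dx :+ β :* Dy :+ 𝟚 :* γ) :* z)
                 refl α β γ δ X Y Dx Dy z ⟩
    (α * X + β * Y + two * δ) + (α * Dx + β * Dy + two * γ) * z ∎

  Contains : Carrier → Carrier → Carrier → Carrier → LineData → Set
  Contains α β γ δ (line X Y Dx Dy) =
    (α * X + β * Y + two * δ ≈ 0#) × (α * Dx + β * Dy + two * γ ≈ 0#)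

  contains⇒⊆ : ∀ α β γ δ L → Contains α β γ δ L → OnLine L ⊆ Z α β γ δ
  contains⇒⊆ α β γ δ L@(line _ _ _ _) (c₀ , c₁) (x , y , z) on = halve-zero (begin
    two * (α * x + β * y + γ * z + δ) ≈⟨ form-along-line α β γ δ L x y z on ⟩
    _ + _ * z                        ≈⟨ +-cong c₀ (*-congʳ c₁) ⟩
    0# + 0# * z                      ≈⟨ trans (+-identityˡ _) (zeroˡ z) ⟩
    0#                               ∎)

  ⊆⇒contains : ∀ α β γ δ L → OnLine L ⊆ Z α β γ δ → Contains α β γ δ L
  ⊆⇒contains α β γ δ L@(line _ _ _ _) L⊆Z = affine-unique λ z → begin
    _ + _ * z         ≈⟨ form-along-line α β γ δ L _ _ z (pointAt-on L z) ⟨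
    two * _           ≈⟨ *-congˡ (L⊆Z (pointAt L z) (pointAt-on L z)) ⟩
    two * 0#          ≈⟨ zeroʳ two ⟩
    0#                ≈⟨ trans (+-identityˡ _) (zeroˡ z) ⟨
    0# + 0# * z       ∎

  -- If ℓ_{a,c} and ℓ_{b,d} lie in a common plane Z(s x + y + k) with s² = -1,
  -- then b - a is an isotropic vector: Δ(a,b) = 0.  Subtracting the
  -- conditions for the two lines gives u = (a₂-b₂) + s(a₁-b₁) = 0, and
  -- Δ(a,b) = ((a₂-b₂) - s(a₁-b₁)) u + (1 + s²)(a₁-b₁)².
  isotropic : ∀ s k a b c d → s * s ≈ - 1# →
    Contains s 1# 0# k (coefficients a c) → Contains s 1# 0# k (coefficients b d) →
    Δ a b ≈ 0#
  isotropic s k (a₁ , a₂) (b₁ , b₂) (c₁ , c₂) (d₁ , d₂) s²≈-1 (e₁ , e₂) (e₃ , e₄) = begin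
    Δ (a₁ , a₂) (b₁ , b₂)
      ≈⟨ solve 5 (λ a₁ a₂ b₁ b₂ s →
                   (a₁ :- b₁) :* (a₁ :- b₁) :+ (a₂ :- b₂) :* (a₂ :- b₂)
                   := ((a₂ :- b₂) :- s :* (a₁ :- b₁)) :* ((a₂ :- b₂) :+ s :* (a₁ :- b₁))
                      :+ (𝟙 :+ s :* s) :* ((a₁ :- b₁) :* (a₁ :- b₁)))
                 refl a₁ a₂ b₁ b₂ s ⟩
    ((a₂ - b₂) - s * (a₁ - b₁)) * u + (1# + s * s) * sq (a₁ - b₁)
      ≈⟨ +-cong (*-congˡ u≈0) (*-congʳ 1+s²≈0) ⟩
    _ * 0# + 0# * _
      ≈⟨ trans (+-cong (zeroʳ _) (zeroˡ _)) (+-identityʳ 0#) ⟩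
    0# ∎
    where
    u : Carrier
    u = (a₂ - b₂) + s * (a₁ - b₁)

    1+s²≈0 : 1# + s * s ≈ 0#
    1+s²≈0 = trans (+-congˡ s²≈-1) (-‿inverseʳ 1#)

    u≈0 : u ≈ 0#
    u≈0 = halve-zero (begin
      two * u
        ≈⟨ solve 10 (λ a₁ a₂ b₁ b₂ c₁ c₂ d₁ d₂ s k →
             𝟚 :* ((a₂ :- b₂) :+ s :* (a₁ :- b₁))
             := ((s :* (a₁ :+ c₁) :+ 𝟙 :* (a₂ :+ c₂) :+ 𝟚 :* k)
                  :- (s :* (b₁ :+ d₁) :+ 𝟙 :* (b₂ :+ d₂) :+ 𝟚 :* k))
                :- s :* ((s :* (a₂ :- c₂) :+ 𝟙 :* (c₁ :- a₁) :+ 𝟚 :* 𝟘)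
                         :- (s :* (b₂ :- d₂) :+ 𝟙 :* (d₁ :- b₁) :+ 𝟚 :* 𝟘))
                :+ (𝟙 :+ s :* s) :* ((a₂ :- b₂) :- (c₂ :- d₂)))
             refl a₁ a₂ b₁ b₂ c₁ c₂ d₁ d₂ s k ⟩
      (_ - _) - s * (_ - _) + (1# + s * s) * _
        ≈⟨ +-cong (+-cong (+-cong e₁ (-‿cong e₃)) (-‿cong (*-congˡ (+-cong e₂ (-‿cong e₄)))))
                  (*-congʳ 1+s²≈0) ⟩
      (0# - 0#) - s * (0# - 0#) + 0# * _
        ≈⟨ solve 2 (λ s w → (𝟘 :- 𝟘) :- s :* (𝟘 :- 𝟘) :+ 𝟘 :* w := 𝟘) refl s _ ⟩
      0# ∎)

  isotropic-plane : ∀ s k a b c d → s * s ≈ - 1# →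
    ℓ a c ⊆ Z s 1# 0# k → ℓ b d ⊆ Z s 1# 0# k → Δ a b ≈ 0#
  isotropic-plane s k a b c d s²≈-1 ac⊆Z bd⊆Z = isotropic s k a b c d s²≈-1
    (⊆⇒contains s 1# 0# k (coefficients a c) ac⊆Z)
    (⊆⇒contains s 1# 0# k (coefficients b d) bd⊆Z)

  -- Hence a plane containing ℓ_{a,c} and ℓ_{b,d} with Δ(a,b) ≠ 0 is not bad
  -- (for Z(y - i x + k) use the other square root -i of -1).
  not-bad : ∀ a b c d (π : Plane) → ℓ a c ⊆ ZP π → ℓ b d ⊆ ZP π →
    ¬ (Δ a b ≈ 0#) → ¬ Bad π
  not-bad a b c d π ac⊆π bd⊆π Δ≉0 (k , i , i²≈-1 , π≡Z) = Δ≉0 (isotropic-either π≡Z)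
    where
    into : ∀ {S T} → SameSet (ZP π) T → S ⊆ ZP π → S ⊆ T
    into π≡T S⊆π p p∈S = proj₁ (π≡T p) (S⊆π p p∈S)

    isotropic-either : SameSet (ZP π) (Z i 1# 0# k) ⊎ SameSet (ZP π) (Z (- i) 1# 0# k) →
      Δ a b ≈ 0#
    isotropic-either (inj₁ π≡Z) =
      isotropic-plane i k a b c d i²≈-1 (into π≡Z ac⊆π) (into π≡Z bd⊆π)
    isotropic-either (inj₂ π≡Z) =
      isotropic-plane (- i) k a b c d (trans (-i*-i≈i*i i) i²≈-1) (into π≡Z ac⊆π) (into π≡Z bd⊆π)
      where
      -i*-i≈i*i : ∀ x → - x * - x ≈ x * x
      -i*-i≈i*i = solve 1 (λ x → :- x :* :- x := x :* x) refl

  plane-through : (α β : Carrier) → ¬ (α ≈ 0# × β ≈ 0#) → LineData → Plane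
  plane-through α β αβ≉0 (line X Y Dx Dy) =
    plane α β (- (half * (α * Dx + β * Dy))) (- (half * (α * X + β * Y)))
          (λ (α≈0 , β≈0 , _) → αβ≉0 (α≈0 , β≈0))

  plane-through-contains : ∀ α β αβ≉0 L L' →
    α * (LineData.X L - LineData.X L') + β * (LineData.Y L - LineData.Y L') ≈ 0# →
    α * (LineData.Dx L - LineData.Dx L') + β * (LineData.Dy L - LineData.Dy L') ≈ 0# →
    OnLine L' ⊆ ZP (plane-through α β αβ≉0 L)
  plane-through-contains α β αβ≉0 (line _ _ _ _) L' e₀ e₁ =
    contains⇒⊆ α β _ _ L' (offset e₀ , offset e₁)
    where
    offset : ∀ {p q p' q'} → α * (p - p') + β * (q - q') ≈ 0# →
      α * p' + β * q' + two * (- (half * (α * p + β * q))) ≈ 0#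
    offset {p} {q} {p'} {q'} e = begin
      α * p' + β * q' + two * (- (half * (α * p + β * q)))
        ≈⟨ +-congˡ (trans (solve 2 (λ t v → t :* (:- v) := :- (t :* v)) refl two _)
                          (-‿cong (double-of-half _))) ⟩
      α * p' + β * q' - (α * p + β * q)
        ≈⟨ solve 6 (λ α β p q p' q' → α :* p' :+ β :* q' :- (α :* p :+ β :* q)
                     := :- (α :* (p :- p') :+ β :* (q :- q'))) refl α β p q p' q' ⟩
      - (α * (p - p') + β * (q - q')) ≈⟨ -‿cong e ⟩
      - 0#                            ≈⟨ ε⁻¹≈ε ⟩
      0#                              ∎

  plane-through-contains-self : ∀ α β αβ≉0 L → OnLine L ⊆ ZP (plane-through α β αβ≉0 L)
  plane-through-contains-self α β αβ≉0 L =
    plane-through-contains α β αβ≉0 L L (no-difference _ _) (no-difference _ _)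
    where
    no-difference : ∀ p q → α * (p - p) + β * (q - q) ≈ 0#
    no-difference = solve 4 (λ α β p q → α :* (p :- p) :+ β :* (q :- q) := 𝟘) refl α β

module QuadruplesToLines (K : ACF0) where
  open ACF0 K
  open CommutativeRing cring
  open Geometry K
  open IntegerCoefficients cring
  open LinearAlgebra cring using (singular-kernel)
  open LinesAndPlanes K
  open import Algebra.Properties.Group +-group using (x∙y⁻¹≈ε⇒x≈y; x≈y⇒x∙y⁻¹≈ε)
  open import Relation.Binary.Reasoning.Setoid setoid

  lines-of : Quad → LineRep × LineRep
  lines-of (a , b , c , d) = (a , c) , (b , d)

  lines-of-reflects : ∀ x y → lines-of x ≈LL lines-of y → x ≈₄ y
  lines-of-reflects (a , b , c , d) (a' , b' , c' , d') (ac≡ac' , bd≡bd') =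
    proj₁ a,c≈ , proj₁ b,d≈ , proj₂ a,c≈ , proj₂ b,d≈
    where
    a,c≈ : (a ≈₂ a') × (c ≈₂ c')
    a,c≈ = ℓ-injective a c a' c' λ p → proj₁ (ac≡ac' p)
    b,d≈ : (b ≈₂ b') × (d ≈₂ d')
    b,d≈ = ℓ-injective b d b' d' λ p → proj₁ (bd≡bd' p)

  SameSet-sym : ∀ {S T} → SameSet S T → SameSet T S
  SameSet-sym S≡T p = proj₂ (S≡T p) , proj₁ (S≡T p)

  SameSet-trans : ∀ {S T U} → SameSet S T → SameSet T U → SameSet S U
  SameSet-trans S≡T T≡U p =
    (λ s → proj₁ (T≡U p) (proj₁ (S≡T p) s)) , (λ u → proj₂ (S≡T p) (proj₂ (T≡U p) u))

  ≈LL-sym : ∀ {x y} → x ≈LL y → y ≈LL x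
  ≈LL-sym (e₁ , e₂) = SameSet-sym e₁ , SameSet-sym e₂

  ≈LL-trans : ∀ {x y z} → x ≈LL y → y ≈LL z → x ≈LL z
  ≈LL-trans (e₁ , e₂) (f₁ , f₂) = SameSet-trans e₁ f₁ , SameSet-trans e₂ f₂

  determinant : ∀ a₁ a₂ b₁ b₂ c₁ c₂ d₁ d₂ →
    ((a₁ + c₁) - (b₁ + d₁)) * ((c₁ - a₁) - (d₁ - b₁))
      - ((a₂ + c₂) - (b₂ + d₂)) * ((a₂ - c₂) - (b₂ - d₂))
    ≈ Δ (c₁ , c₂) (d₁ , d₂) - Δ (a₁ , a₂) (b₁ , b₂)
  determinant = solve 8 (λ a₁ a₂ b₁ b₂ c₁ c₂ d₁ d₂ →
      ((a₁ :+ c₁) :- (b₁ :+ d₁)) :* ((c₁ :- a₁) :- (d₁ :- b₁))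
        :- ((a₂ :+ c₂) :- (b₂ :+ d₂)) :* ((a₂ :- c₂) :- (b₂ :- d₂))
      := ((c₁ :- d₁) :* (c₁ :- d₁) :+ (c₂ :- d₂) :* (c₂ :- d₂))
         :- ((a₁ :- b₁) :* (a₁ :- b₁) :+ (a₂ :- b₂) :* (a₂ :- b₂)))
    refl

  Δ-self : ∀ a b → a ≈₂ b → Δ a b ≈ 0#
  Δ-self (a₁ , a₂) (b₁ , b₂) (a₁≈b₁ , a₂≈b₂) = begin
    sq (a₁ - b₁) + sq (a₂ - b₂)
      ≈⟨ +-cong (*-cong d₁≈0 d₁≈0) (*-cong d₂≈0 d₂≈0) ⟩
    0# * 0# + 0# * 0#
      ≈⟨ trans (+-cong (zeroˡ 0#) (zeroˡ 0#)) (+-identityʳ 0#) ⟩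
    0# ∎
    where
    d₁≈0 : a₁ - b₁ ≈ 0#
    d₁≈0 = x≈y⇒x∙y⁻¹≈ε a₁≈b₁
    d₂≈0 : a₂ - b₂ ≈ 0#
    d₂≈0 = x≈y⇒x∙y⁻¹≈ε a₂≈b₂

  -- Every (a,b,c,d) ∈ Q(𝒫) gives a pair of lines in a common plane that is
  -- not bad: the system for the plane is singular since Δ(a,b) = Δ(c,d), and
  -- it is not identically zero since otherwise a = b, contradicting
  -- Δ(a,b) ≠ 0.
  quadruple-good : ∀ 𝒫 x → Q 𝒫 x → ¬ ¬ GoodPair 𝒫 (lines-of x)
  quadruple-good 𝒫 (a@(a₁ , a₂) , b@(b₁ , b₂) , c@(c₁ , c₂) , d@(d₁ , d₂))
                 (a∈𝒫 , b∈𝒫 , c∈𝒫 , d∈𝒫 , Δab≈Δcd , Δab≉0 , _) =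
    ¬¬-map good-pair (singular-kernel singular not-all-zero)
    where
    dX dY dDx dDy : Carrier
    dX  = (a₁ + c₁) - (b₁ + d₁)
    dY  = (a₂ + c₂) - (b₂ + d₂)
    dDx = (a₂ - c₂) - (b₂ - d₂)
    dDy = (c₁ - a₁) - (d₁ - b₁)

    singular : dX * dDy - dY * dDx ≈ 0#
    singular = trans (determinant a₁ a₂ b₁ b₂ c₁ c₂ d₁ d₂) (x≈y⇒x∙y⁻¹≈ε (sym Δab≈Δcd))

    not-all-zero : ¬ (dX ≈ 0# × dY ≈ 0# × dDx ≈ 0# × dDy ≈ 0#)
    not-all-zero (eX , eY , eDx , eDy) =
      Δab≉0 (Δ-self a b (proj₁ (points-unique a c b d
        (x∙y⁻¹≈ε⇒x≈y _ _ eX , x∙y⁻¹≈ε⇒x≈y _ _ eY , x∙y⁻¹≈ε⇒x≈y _ _ eDx , x∙y⁻¹≈ε⇒x≈y _ _ eDy))))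

    good-pair : (∃₂ λ α β → ¬ (α ≈ 0# × β ≈ 0#) × α * dX + β * dY ≈ 0# × α * dDx + β * dDy ≈ 0#) →
      GoodPair 𝒫 (lines-of (a , b , c , d))
    good-pair (α , β , αβ≉0 , eXY , eD) =
      (a∈𝒫 , c∈𝒫) , (b∈𝒫 , d∈𝒫) , π , ac⊆π , bd⊆π , not-bad a b c d π ac⊆π bd⊆π Δab≉0
      where
      π : Plane
      π = plane-through α β αβ≉0 (coefficients a c)

      ac⊆π : ℓ a c ⊆ ZP π
      ac⊆π = plane-through-contains-self α β αβ≉0 (coefficients a c)

      bd⊆π : ℓ b d ⊆ ZP π
      bd⊆π = plane-through-contains α β αβ≉0 (coefficients a c) (coefficients b d) eXY eD

lemma7p5 : (K : ACF0) → (𝒫 : List (Geometry.Point2 K)) → (n m : ℕ) →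
    IsCard (Geometry._≈₄_ K) (Geometry.Q K 𝒫) n →
    IsCard (Geometry._≈LL_ K) (Geometry.GoodPair K 𝒫) m →
    n ≤ m
lemma7p5 K 𝒫 n m =
  card-≤ ≈LL-sym ≈LL-trans lines-of lines-of-reflects (quadruple-good 𝒫)
  where open QuadruplesToLines K
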